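{- Let $G$ and $H$ be graphs (possibly with multiple ordinary edges, loops and semi-edges) and let $f=(f_V,f_E)$ be a covering projection from $G$ to $H$. Then the vertex mapping $f_V$ is degree-obedient.
   Context: A graph is finite and may have three kinds of edges: ordinary edges, each incident with two distinct vertices (parallel ordinary edges allowed); loops, each incident with one vertex; and semi-edges, each incident with one vertex. The degree of a vertex $u$ is (number of semi-edges at $u$) + (number of ordinary edges at $u$) + 2(number of loops at $u$). A covering projection $f:G\to H$ is a pair of maps $f_V:V(G)\to V(H)$, $f_E:E(G)\to E(H)$ such that: every loop of $G$ at $u$ maps to a loop of $H$ at $f_V(u)$; every semi-edge of $G$ at $u$ maps to a semi-edge of $H$ at $f_V(u)$; every ordinary edge $uv$ of $G$ maps either to an ordinary edge of $H$ with end-vertices $f_V(u)\ne f_V(v)$, or, when $f_V(u)=f_V(v)$, to a loop or semi-edge of $H$ at $f_V(u)$; for every loop $e$ of $H$ at $w$, $f_E^{ -1}(e)$ is a disjoint union of loops and cycles spanning all vertices of $f_V^{ -1}(w)$; for every semi-edge $e$ of $H$ at $w$, $f_E^{ -1}(e)$ is a disjoint union of ordinary edges and semi-edges spanning all vertices of $f_V^{ -1}(w)$ (each such vertex incident with exactly one of them); for every ordinary edge $e$ of $H$ with end-vertices $w,w'$, $f_E^{ -1}(e)$ is a matching of ordinary edges spanning all vertices of $f_V^{ -1}(w)\cup f_V^{ -1}(w')$. A vertex mapping $f_V:V(G)\to V(H)$ is degree-obedient if: (1) for any distinct $u,v\in V(H)$ and any $x\in f_V^{ -1}(u)$, the number of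 ordinary edges of $H$ joining $u$ and $v$ equals the number of ordinary edges of $G$ joining $x$ to a vertex of $f_V^{ -1}(v)$; (2) for every $u\in V(H)$ and $x\in f_V^{ -1}(u)$, (number of semi-edges of $H$ at $u$) + 2(number of loops of $H$ at $u$) equals (number of semi-edges of $G$ at $x$) + 2(number of loops of $G$ at $x$) + $r$, where $r$ is the number of ordinary edges of $G$ joining $x$ to a vertex of $f_V^{ -1}(u)\setminus\{x\}$; (3) for every $u\in V(H)$ and $x\in f_V^{ -1}(u)$, the number of semi-edges of $G$ at $x$ is at most the number of semi-edges of $H$ at $u$. -}

module Defs where

open import Data.Nat using (ℕ; zero; suc; _+_; _*_; _≤_)
open import Data.Fin using (Fin; zero; suc; _≟_)
open import Data.Bool using (Bool; true; false; _∧_; _∨_; if_then_else_)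
open import Data.Product using (_×_)
open import Data.Sum using (_⊎_)
open import Relation.Nullary using (¬_; does)
open import Relation.Binary.PropositionalEquality using (_≡_; _≢_)

data Edge (n : ℕ) : Set where
  ord  : Fin n → Fin n → Edge n
  loop : Fin n → Edge n
  semi : Fin n → Edge n

record Graph : Set where
  field
    nV   : ℕ
    nE   : ℕ
    edge : Fin nE → Edge nV
    ordDistinct : ∀ e u v → edge e ≡ ord u v → u ≢ v
open Graph public

count : ∀ {m} → (Fin m → Bool) → ℕ
count {zero}  p = 0
count {suc m} p = (if p zero then 1 else 0) + count {m} (λ i → p (suc i))

_==_ : ∀ {n} → Fin n → Fin n → Bool
a == b = does (a ≟ b)

isSemiAt : ∀ {n} → Fin n → Edge n → Bool
isSemiAt x (semi u) = u == x
isSemiAt x _        = false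

isLoopAt : ∀ {n} → Fin n → Edge n → Bool
isLoopAt x (loop u) = u == x
isLoopAt x _        = false

ordJoins : ∀ {n} → Fin n → (Fin n → Bool) → Edge n → Bool
ordJoins x P (ord a b) = ((a == x) ∧ P b) ∨ ((b == x) ∧ P a)
ordJoins x P _         = false

module _ (G : Graph) where
  semiCount : Fin (nV G) → ℕ
  semiCount x = count (λ e → isSemiAt x (edge G e))

  loopCount : Fin (nV G) → ℕ
  loopCount x = count (λ e → isLoopAt x (edge G e))

  ordTo : Fin (nV G) → (Fin (nV G) → Bool) → ℕ
  ordTo x P = count (λ e → ordJoins x P (edge G e))

  degIn : (Fin (nE G) → Bool) → Fin (nV G) → ℕ
  degIn S x = count (λ e → S e ∧ isSemiAt x (edge G e))
            + count (λ e → S e ∧ ordJoins x (λ _ → true) (edge G e))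
            + 2 * count (λ e → S e ∧ isLoopAt x (edge G e))

EdgeImageOK : ∀ {n m} → (Fin n → Fin m) → Edge n → Edge m → Set
EdgeImageOK fV (loop u)  h = h ≡ loop (fV u)
EdgeImageOK fV (semi u)  h = h ≡ semi (fV u)
EdgeImageOK fV (ord u v) h =
  (fV u ≢ fV v → (h ≡ ord (fV u) (fV v) ⊎ h ≡ ord (fV v) (fV u)))
  × (fV u ≡ fV v → (h ≡ loop (fV u) ⊎ h ≡ semi (fV u)))

-- Condition on the preimage f_E^{-1}(e) of an edge e of H,
-- given the degree function of that preimage (as a spanning subgraph of G).
FibreOK : ∀ {n m} → (Fin n → Fin m) → (Fin n → ℕ) → Edge m → Set
-- loop at w: preimage is a disjoint union of loops and cycles spanning f_V^{-1}(w),
-- i.e. a 2-regular subgraph on f_V^{-1}(w) (loops counting 2)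
FibreOK fV deg (loop w)   = ∀ x → fV x ≡ w → deg x ≡ 2
FibreOK fV deg (semi w)   = ∀ x → fV x ≡ w → deg x ≡ 1
-- ordinary edge ww': preimage is a perfect matching of f_V^{-1}(w) ∪ f_V^{-1}(w')
FibreOK fV deg (ord w w') = ∀ x → (fV x ≡ w ⊎ fV x ≡ w') → deg x ≡ 1

record IsCovering (G H : Graph) (fV : Fin (nV G) → Fin (nV H))
                  (fE : Fin (nE G) → Fin (nE H)) : Set where
  field
    edgeImage : ∀ e → EdgeImageOK fV (edge G e) (edge H (fE e))
    fibre     : ∀ e' → FibreOK fV (degIn G (λ e → fE e == e')) (edge H e')

record DegreeObedient (G H : Graph) (fV : Fin (nV G) → Fin (nV H)) : Set where
  field
    cond1 : ∀ (u v : Fin (nV H)) → u ≢ v → ∀ x → fV x ≡ u →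
            ordTo H u (λ y → y == v) ≡ ordTo G x (λ y → fV y == v)
    cond2 : ∀ (u : Fin (nV H)) x → fV x ≡ u →
            semiCount H u + 2 * loopCount H u
              ≡ semiCount G x + 2 * loopCount G x
                + ordTo G x (λ y → (fV y == u) ∧ Data.Bool.not (y == x))
    cond3 : ∀ (u : Fin (nV H)) x → fV x ≡ u → semiCount G x ≤ semiCount H u

{-# OPTIONS --safe #-}
-- Every count at a vertex x of G splits, along f_E, into a sum over the edges e' of H of
-- the same count inside the preimage of e'. Inside one preimage the spanning condition
-- forces everything: over an ordinary edge at f_V(x) the vertex x meets exactly one edge,
-- an ordinary one whose other end lies over the other end of e'; over a semi-edge or loop
-- at f_V(x) the ordinary edges at x stay inside the fibre of f_V(x), and with the
-- semi-edges and loops at x they make up degree 1 or 2; over any other edge of H there are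
-- no semi-edges or loops at x.
module Submission where

open import Defs
open import Data.Bool using (Bool; true; false; _∧_; _∨_; not; if_then_else_)
open import Data.Bool.Properties using (∧-identityʳ; ∧-zeroʳ; ∨-identityʳ)
open import Data.Empty using (⊥-elim)
open import Data.Fin using (Fin; zero; suc)
open import Data.Fin.Properties using (_≟_)
open import Data.Nat using (ℕ; zero; suc; _+_; _*_; _≤_; z≤n)
open import Data.Nat.Properties
  using (+-identityʳ; +-mono-≤; m≤m+n; ≤-trans; ≤-reflexive; +-commutativeSemigroup; +-*-semiring;
         module ≤-Reasoning)
open import Algebra.Properties.CommutativeSemigroup +-commutativeSemigroup using (xy∙z≈xz∙y)
open import Algebra.Properties.Semiring.Sum +-*-semiring
  using (sum; sum-cong-≗; ∑-distrib-+; ∑-comm; *-distribˡ-sum; sum-replicate-zero)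
open import Data.Product using (_,_)
open import Data.Sum using (_⊎_; inj₁; inj₂; swap)
open import Function using (_∘_)
open import Relation.Nullary using (yes; no; contradiction)
open import Relation.Nullary.Decidable using (dec-true; dec-false)
open import Relation.Binary.PropositionalEquality

indicator : Bool → ℕ
indicator b = if b then 1 else 0

∧-cong-guarded : ∀ {b x y} → (b ≡ true → x ≡ y) → b ∧ x ≡ b ∧ y
∧-cong-guarded {true}  x≡y = x≡y refl
∧-cong-guarded {false} _   = refl

contraposeᵇ : ∀ {a b} → (a ≡ true → b ≡ true) → b ≡ false → a ≡ false
contraposeᵇ {false} _   _      = refl
contraposeᵇ {true}  a⇒b b≡false = contradiction (trans (sym (a⇒b refl)) b≡false) λ ()

if-then-0≡indicator : ∀ b {n} → (b ≡ true → n ≡ 1) → (if b then n else 0) ≡ indicator b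
if-then-0≡indicator true  n≡1 = n≡1 refl
if-then-0≡indicator false _   = refl

==⇒≡ : ∀ {n} {a b : Fin n} → (a == b) ≡ true → a ≡ b
==⇒≡ {a = a} {b} a==b with a ≟ b
... | yes a≡b = a≡b
==⇒≡ {a = a} {b} () | no _

==-refl : ∀ {n} (a : Fin n) → (a == a) ≡ true
==-refl a = dec-true (a ≟ a) refl

sum-mono-≤ : ∀ {m} {f g : Fin m → ℕ} → (∀ i → f i ≤ g i) → sum f ≤ sum g
sum-mono-≤ {zero}  f≤g = z≤n
sum-mono-≤ {suc m} f≤g = +-mono-≤ (f≤g zero) (sum-mono-≤ (f≤g ∘ suc))

∑-distrib-+-* : ∀ {m} k (f g : Fin m → ℕ) → sum (λ i → f i + k * g i) ≡ sum f + k * sum g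
∑-distrib-+-* k f g =
  trans (∑-distrib-+ f (λ i → k * g i)) (cong (sum f +_) (sym (*-distribˡ-sum k g)))

sum-indicator-== : ∀ {m} (c : Fin m) → sum (λ j → indicator (c == j)) ≡ 1
sum-indicator-== {suc m} zero    = cong suc (sum-replicate-zero m)
sum-indicator-==         (suc c) = sum-indicator-== c

sum-indicator-==-∧ : ∀ {m} (c : Fin m) b → sum (λ j → indicator ((c == j) ∧ b)) ≡ indicator b
sum-indicator-==-∧ c true =
  trans (sum-cong-≗ (λ j → cong indicator (∧-identityʳ (c == j)))) (sum-indicator-== c)
sum-indicator-==-∧ {m} c false =
  trans (sum-cong-≗ (λ j → cong indicator (∧-zeroʳ (c == j)))) (sum-replicate-zero m)

count≡sum : ∀ {m} (p : Fin m → Bool) → count p ≡ sum (indicator ∘ p)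
count≡sum {zero}  p = refl
count≡sum {suc m} p = cong (indicator (p zero) +_) (count≡sum (p ∘ suc))

count-cong : ∀ {m} {p q : Fin m → Bool} → (∀ i → p i ≡ q i) → count p ≡ count q
count-cong {m} {p} {q} p≗q =
  trans (count≡sum p) (trans (sum-cong-≗ (cong indicator ∘ p≗q)) (sym (count≡sum q)))

count-false : ∀ m → count {m} (λ _ → false) ≡ 0
count-false m = trans (count≡sum {m} _) (sum-replicate-zero m)

count-∧-cong : ∀ {m} {s p q : Fin m → Bool} → (∀ i → s i ≡ true → p i ≡ q i) →
               count (λ i → s i ∧ p i) ≡ count (λ i → s i ∧ q i)
count-∧-cong p≗q = count-cong (λ i → ∧-cong-guarded (p≗q i))

count-∧-vanish : ∀ {m} {s p : Fin m → Bool} → (∀ i → s i ≡ true → p i ≡ false) →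
                 count (λ i → s i ∧ p i) ≡ 0
count-∧-vanish {m} {s} p≡false =
  trans (count-cong (λ i → trans (∧-cong-guarded (p≡false i)) (∧-zeroʳ (s i)))) (count-false m)

count-∧-const : ∀ {m} (s p : Fin m → Bool) b →
                count (λ i → s i ∧ (p i ∧ b)) ≡ (if b then count (λ i → s i ∧ p i) else 0)
count-∧-const s p true  = count-cong (λ i → cong (s i ∧_) (∧-identityʳ (p i)))
count-∧-const s p false = count-∧-vanish {s = s} (λ i _ → ∧-zeroʳ (p i))

-- Double counting along f: every i lies over exactly one c.
count-fibres : ∀ {n m} (f : Fin n → Fin m) (p : Fin n → Bool) →
               count p ≡ sum (λ c → count (λ i → (f i == c) ∧ p i))
count-fibres f p = begin
  count p
    ≡⟨ count≡sum p ⟩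
  sum (λ i → indicator (p i))
    ≡⟨ sum-cong-≗ (λ i → sum-indicator-==-∧ (f i) (p i)) ⟨
  sum (λ i → sum (λ c → indicator ((f i == c) ∧ p i)))
    ≡⟨ ∑-comm (λ i c → indicator ((f i == c) ∧ p i)) ⟩
  sum (λ c → sum (λ i → indicator ((f i == c) ∧ p i)))
    ≡⟨ sum-cong-≗ (λ c → count≡sum (λ i → (f i == c) ∧ p i)) ⟨
  sum (λ c → count (λ i → (f i == c) ∧ p i))
    ∎
  where open ≡-Reasoning

ordJoins-source : ∀ {n} (P : Fin n → Bool) {u w} → u ≢ w → ordJoins u P (ord u w) ≡ P w
ordJoins-source P {u} {w} u≢w
  rewrite ==-refl u | dec-false (w ≟ u) (u≢w ∘ sym) = ∨-identityʳ (P w)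

ordJoins-target : ∀ {n} (P : Fin n → Bool) {u w} → u ≢ w → ordJoins u P (ord w u) ≡ P w
ordJoins-target P {u} {w} u≢w
  rewrite ==-refl u | dec-false (w ≟ u) (u≢w ∘ sym) = refl

ordJoins-otherEnd : ∀ {n} {x : Fin n} {P g} {Q : Bool} → (∀ a b → g ≡ ord a b → a ≢ b) →
                    (∀ y → y ≢ x → g ≡ ord x y ⊎ g ≡ ord y x → P y ≡ Q) →
                    ordJoins x P g ≡ ordJoins x (λ _ → true) g ∧ Q
ordJoins-otherEnd {x = x} {g = ord a b} distinct end with a ≟ x | b ≟ x
... | yes refl | yes refl = ⊥-elim (distinct a a refl refl)
... | yes refl | no b≢a   = trans (∨-identityʳ _) (end b b≢a (inj₁ refl))
... | no a≢b   | yes refl = end a a≢b (inj₂ refl)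
... | no _     | no _     = refl
ordJoins-otherEnd {g = loop _} _ _ = refl
ordJoins-otherEnd {g = semi _} _ _ = refl

module EdgeImage {n m} (fV : Fin n → Fin m) where

  isSemiAt-image : ∀ {x g h} → EdgeImageOK fV g h → isSemiAt x g ≡ true → isSemiAt (fV x) h ≡ true
  isSemiAt-image {x} {semi a} refl a==x = dec-true (fV a ≟ fV x) (cong fV (==⇒≡ a==x))

  isLoopAt-image : ∀ {x g h} → EdgeImageOK fV g h → isLoopAt x g ≡ true → isLoopAt (fV x) h ≡ true
  isLoopAt-image {x} {loop a} refl a==x = dec-true (fV a ≟ fV x) (cong fV (==⇒≡ a==x))

  ordImage-flip : ∀ {a b h} → EdgeImageOK fV (ord a b) h → EdgeImageOK fV (ord b a) h
  ordImage-flip {h = h} (apart , together) =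
    (λ fb≢fa → swap (apart (fb≢fa ∘ sym))) ,
    (λ fb≡fa → subst (λ w → h ≡ loop w ⊎ h ≡ semi w) (sym fb≡fa) (together (sym fb≡fa)))

  ordJoins-image : ∀ {x g h} {P} {Q : Bool} → (∀ a b → g ≡ ord a b → a ≢ b) → EdgeImageOK fV g h →
                   (∀ y → y ≢ x → EdgeImageOK fV (ord x y) h → P y ≡ Q) →
                   ordJoins x P g ≡ ordJoins x (λ _ → true) g ∧ Q
  ordJoins-image {x} {g} {h} distinct ok end = ordJoins-otherEnd distinct endpoint
    where
      endpoint : ∀ y → y ≢ x → g ≡ ord x y ⊎ g ≡ ord y x → _
      endpoint y y≢x (inj₁ g≡xy) = end y y≢x (subst (λ g → EdgeImageOK fV g h) g≡xy ok)
      endpoint y y≢x (inj₂ g≡yx) = end y y≢x (ordImage-flip (subst (λ g → EdgeImageOK fV g h) g≡yx ok))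

  otherEnd-toFibre : ∀ {x y v h} → fV x ≢ v → EdgeImageOK fV (ord x y) h →
                     (fV y == v) ≡ ordJoins (fV x) (_== v) h
  otherEnd-toFibre {x} {y} {v} fx≢v (apart , together) with fV x ≟ fV y
  ... | yes fx≡fy = trans (dec-false (fV y ≟ v) (fx≢v ∘ trans fx≡fy)) (loopOrSemi (together fx≡fy))
    where
      loopOrSemi : ∀ {h} → h ≡ loop (fV x) ⊎ h ≡ semi (fV x) → false ≡ ordJoins (fV x) (_== v) h
      loopOrSemi (inj₁ refl) = refl
      loopOrSemi (inj₂ refl) = refl
  ... | no fx≢fy with apart fx≢fy
  ...   | inj₁ refl = sym (ordJoins-source (_== v) fx≢fy)
  ...   | inj₂ refl = sym (ordJoins-target (_== v) fx≢fy)

  otherEnd-sameFibre : ∀ {x y h} → y ≢ x → EdgeImageOK fV (ord x y) h →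
                       ((fV y == fV x) ∧ not (y == x)) ≡ isSemiAt (fV x) h ∨ isLoopAt (fV x) h
  otherEnd-sameFibre {x} {y} y≢x (apart , together)
    rewrite dec-false (y ≟ x) y≢x | ∧-identityʳ (fV y == fV x) with fV x ≟ fV y
  ... | yes fx≡fy = trans (dec-true (fV y ≟ fV x) (sym fx≡fy)) (loopOrSemi (together fx≡fy))
    where
      loopOrSemi : ∀ {h} → h ≡ loop (fV x) ⊎ h ≡ semi (fV x) →
                   true ≡ isSemiAt (fV x) h ∨ isLoopAt (fV x) h
      loopOrSemi (inj₁ refl) = sym (==-refl (fV x))
      loopOrSemi (inj₂ refl) = sym (cong (_∨ false) (==-refl (fV x)))
  ... | no fx≢fy with apart fx≢fy
  ...   | inj₁ refl = dec-false (fV y ≟ fV x) (fx≢fy ∘ sym)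
  ...   | inj₂ refl = dec-false (fV y ≟ fV x) (fx≢fy ∘ sym)

module _ (G : Graph) (S : Fin (nE G) → Bool) where

  semiCountIn loopCountIn : Fin (nV G) → ℕ
  semiCountIn x = count (λ e → S e ∧ isSemiAt x (edge G e))
  loopCountIn x = count (λ e → S e ∧ isLoopAt x (edge G e))

  ordToIn : Fin (nV G) → (Fin (nV G) → Bool) → ℕ
  ordToIn x P = count (λ e → S e ∧ ordJoins x P (edge G e))

  degIn-reorder : ∀ x → semiCountIn x + 2 * loopCountIn x + ordToIn x (λ _ → true) ≡ degIn G S x
  degIn-reorder x = xy∙z≈xz∙y (semiCountIn x) (2 * loopCountIn x) (ordToIn x (λ _ → true))

-- Stands for f_E⁻¹(h): only these two properties of a covering are used inside one preimage.
record Preimage (G : Graph) {m} (fV : Fin (nV G) → Fin m) (h : Edge m) : Set where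
  field
    member   : Fin (nE G) → Bool
    liesOver : ∀ e → member e ≡ true → EdgeImageOK fV (edge G e) h
    degrees  : FibreOK fV (degIn G member) h
open Preimage

module _ {G : Graph} {m} {fV : Fin (nV G) → Fin m} where
  open EdgeImage fV

  semiCountIn-vanish : ∀ {h} (F : Preimage G fV h) x → isSemiAt (fV x) h ≡ false →
                       semiCountIn G (member F) x ≡ 0
  semiCountIn-vanish F x not-semi =
    count-∧-vanish (λ e e∈F → contraposeᵇ (isSemiAt-image (liesOver F e e∈F)) not-semi)

  loopCountIn-vanish : ∀ {h} (F : Preimage G fV h) x → isLoopAt (fV x) h ≡ false →
                       loopCountIn G (member F) x ≡ 0
  loopCountIn-vanish F x not-loop =
    count-∧-vanish (λ e e∈F → contraposeᵇ (isLoopAt-image (liesOver F e e∈F)) not-loop)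

  ordToIn-restrict : ∀ {h} (F : Preimage G fV h) x {P} {Q : Bool} →
                     (∀ y → y ≢ x → EdgeImageOK fV (ord x y) h → P y ≡ Q) →
                     ordToIn G (member F) x P ≡ (if Q then ordToIn G (member F) x (λ _ → true) else 0)
  ordToIn-restrict F x end =
    trans (count-∧-cong (λ e e∈F → ordJoins-image (ordDistinct G e) (liesOver F e e∈F) end))
          (count-∧-const (member F) _ _)

  ordDegree-at-endpoint : ∀ {w w'} (F : Preimage G fV (ord w w')) x → fV x ≡ w ⊎ fV x ≡ w' →
                          ordToIn G (member F) x (λ _ → true) ≡ 1
  ordDegree-at-endpoint F x endpoint = begin
    o                               ≡⟨ +-identityʳ o ⟨
    0 + o + 2 * 0                   ≡⟨ cong₂ (λ s l → s + o + 2 * l) (semiCountIn-vanish F x refl)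
                                                                    (loopCountIn-vanish F x refl) ⟨
    semiCountIn G (member F) x + o + 2 * loopCountIn G (member F) x ≡⟨ degrees F x endpoint ⟩
    1                               ∎
    where
      open ≡-Reasoning
      o = ordToIn G (member F) x (λ _ → true)

  ordDegree-over-ordinary : ∀ {h} (F : Preimage G fV h) x {P} → ordJoins (fV x) P h ≡ true →
                            ordToIn G (member F) x (λ _ → true) ≡ 1
  ordDegree-over-ordinary {ord w w'} F x joins with w ≟ fV x | w' ≟ fV x
  ... | yes w≡fx | _         = ordDegree-at-endpoint F x (inj₁ (sym w≡fx))
  ... | no _     | yes w'≡fx = ordDegree-at-endpoint F x (inj₂ (sym w'≡fx))
  ordDegree-over-ordinary {ord w w'} F x () | no _ | no _

  ordToIn-toFibre : ∀ {h} (F : Preimage G fV h) x {v} → fV x ≢ v →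
                    ordToIn G (member F) x (λ y → fV y == v) ≡ indicator (ordJoins (fV x) (_== v) h)
  ordToIn-toFibre F x fx≢v =
    trans (ordToIn-restrict F x (λ y _ → otherEnd-toFibre fx≢v))
          (if-then-0≡indicator _ (ordDegree-over-ordinary F x))

  semiLoop-weight : ∀ {h} (F : Preimage G fV h) x →
                    indicator (isSemiAt (fV x) h) + 2 * indicator (isLoopAt (fV x) h)
                      ≡ semiCountIn G (member F) x + 2 * loopCountIn G (member F) x
                        + (if isSemiAt (fV x) h ∨ isLoopAt (fV x) h
                           then ordToIn G (member F) x (λ _ → true) else 0)
  semiLoop-weight {semi w} F x with w ≟ fV x
  ... | yes refl = sym (trans (degIn-reorder G (member F) x) (degrees F x refl))
  ... | no w≢fx  = sym (cong₂ (λ s l → s + 2 * l + 0) (semiCountIn-vanish F x (dec-false (w ≟ fV x) w≢fx))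
                                                     (loopCountIn-vanish F x refl))
  semiLoop-weight {loop w} F x with w ≟ fV x
  ... | yes refl = sym (trans (degIn-reorder G (member F) x) (degrees F x refl))
  ... | no w≢fx  = sym (cong₂ (λ s l → s + 2 * l + 0) (semiCountIn-vanish F x refl)
                                                     (loopCountIn-vanish F x (dec-false (w ≟ fV x) w≢fx)))
  semiLoop-weight {ord _ _} F x =
    sym (cong₂ (λ s l → s + 2 * l + 0) (semiCountIn-vanish F x refl) (loopCountIn-vanish F x refl))

  semiLoop-balance : ∀ {h} (F : Preimage G fV h) x →
                     indicator (isSemiAt (fV x) h) + 2 * indicator (isLoopAt (fV x) h)
                       ≡ semiCountIn G (member F) x + 2 * loopCountIn G (member F) x
                         + ordToIn G (member F) x (λ y → (fV y == fV x) ∧ not (y == x))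
  semiLoop-balance F x =
    trans (semiLoop-weight F x)
          (cong (semiCountIn G (member F) x + 2 * loopCountIn G (member F) x +_)
                (sym (ordToIn-restrict F x (λ _ → otherEnd-sameFibre))))

  semiCountIn-≤ : ∀ {h} (F : Preimage G fV h) x →
                  semiCountIn G (member F) x ≤ indicator (isSemiAt (fV x) h)
  semiCountIn-≤ {semi w} F x with w ≟ fV x
  ... | yes refl = ≤-trans (≤-trans (m≤m+n s _) (m≤m+n (s + _) _)) (≤-reflexive (degrees F x refl))
    where
      s : ℕ
      s = semiCountIn G (member F) x
  ... | no w≢fx  = ≤-reflexive (semiCountIn-vanish F x (dec-false (w ≟ fV x) w≢fx))
  semiCountIn-≤ {loop _}  F x = ≤-reflexive (semiCountIn-vanish F x refl)
  semiCountIn-≤ {ord _ _} F x = ≤-reflexive (semiCountIn-vanish F x refl)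

module Covering {G H : Graph} {fV : Fin (nV G) → Fin (nV H)} {fE : Fin (nE G) → Fin (nE H)}
                (covering : IsCovering G H fV fE) where
  open IsCovering covering

  preimage : (e' : Fin (nE H)) → Preimage G fV (edge H e')
  preimage e' = record
    { member   = λ e → fE e == e'
    ; liesOver = λ e fe==e' →
        subst (λ c → EdgeImageOK fV (edge G e) (edge H c)) (==⇒≡ fe==e') (edgeImage e)
    ; degrees  = fibre e'
    }

  ordTo-preserved : ∀ x v → fV x ≢ v → ordTo H (fV x) (_== v) ≡ ordTo G x (λ y → fV y == v)
  ordTo-preserved x v fx≢v = begin
    ordTo H (fV x) (_== v)
      ≡⟨ count≡sum {nE H} _ ⟩
    sum (λ e' → indicator (ordJoins (fV x) (_== v) (edge H e')))
      ≡⟨ sum-cong-≗ (λ e' → ordToIn-toFibre (preimage e') x fx≢v) ⟨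
    sum (λ e' → ordToIn G (member (preimage e')) x (λ y → fV y == v))
      ≡⟨ count-fibres fE _ ⟨
    ordTo G x (λ y → fV y == v)
      ∎
    where open ≡-Reasoning

  semiLoop-preserved : ∀ x → semiCount H (fV x) + 2 * loopCount H (fV x)
                               ≡ semiCount G x + 2 * loopCount G x
                                 + ordTo G x (λ y → (fV y == fV x) ∧ not (y == x))
  semiLoop-preserved x = begin
    semiCount H (fV x) + 2 * loopCount H (fV x)
      ≡⟨ cong₂ (λ s l → s + 2 * l) (count≡sum {nE H} _) (count≡sum {nE H} _) ⟩
    sum S + 2 * sum L
      ≡⟨ ∑-distrib-+-* 2 S L ⟨
    sum (λ e' → S e' + 2 * L e')
      ≡⟨ sum-cong-≗ (λ e' → semiLoop-balance (preimage e') x) ⟩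
    sum (λ e' → semis e' + 2 * loops e' + ords e')
      ≡⟨ trans (∑-distrib-+ (λ e' → semis e' + 2 * loops e') ords)
               (cong (_+ sum ords) (∑-distrib-+-* 2 semis loops)) ⟩
    sum semis + 2 * sum loops + sum ords
      ≡⟨ cong₂ _+_ (cong₂ (λ s l → s + 2 * l) (count-fibres fE _) (count-fibres fE _))
                   (count-fibres fE _) ⟨
    semiCount G x + 2 * loopCount G x + ordTo G x (λ y → (fV y == fV x) ∧ not (y == x))
      ∎
    where
      open ≡-Reasoning
      S L semis loops ords : Fin (nE H) → ℕ
      S e'     = indicator (isSemiAt (fV x) (edge H e'))
      L e'     = indicator (isLoopAt (fV x) (edge H e'))
      semis e' = semiCountIn G (member (preimage e')) x
      loops e' = loopCountIn G (member (preimage e')) x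
      ords e'  = ordToIn G (member (preimage e')) x (λ y → (fV y == fV x) ∧ not (y == x))

  semiCount-≤ : ∀ x → semiCount G x ≤ semiCount H (fV x)
  semiCount-≤ x = begin
    semiCount G x
      ≡⟨ count-fibres fE _ ⟩
    sum (λ e' → semiCountIn G (member (preimage e')) x)
      ≤⟨ sum-mono-≤ (λ e' → semiCountIn-≤ (preimage e') x) ⟩
    sum (λ e' → indicator (isSemiAt (fV x) (edge H e')))
      ≡⟨ count≡sum {nE H} _ ⟨
    semiCount H (fV x)
      ∎
    where open ≤-Reasoning

proposition5 : (G H : Graph) (fV : Fin (nV G) → Fin (nV H)) (fE : Fin (nE G) → Fin (nE H)) →
               IsCovering G H fV fE → DegreeObedient G H fV
proposition5 G H fV fE covering = record
  { cond1 = λ { _ v fx≢v x refl → ordTo-preserved x v fx≢v }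
  ; cond2 = λ { _ x refl → semiLoop-preserved x }
  ; cond3 = λ { _ x refl → semiCount-≤ x }
  }
  where open Covering covering
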